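{- Let $n \geq 3$ and let $k = n \bmod 4$. Under optimal play, the result of the Sign Game on the cycle graph $C_n$ is: a draw when $k = 0$; a win for Player P when $k = 1$; a win for Player 2 (the player who moves second) when $k = 2$; and a win for Player N when $k = 3$.
   Context: The Sign Game on a simple undirected graph $G$: two players, Player P and Player N, alternate turns; the one moving first is called Player 1, the other Player 2 (either of P, N may be Player 1). On a turn a player assigns $+1$ or $-1$ to a vertex of $G$ not yet assigned. Once both endpoints of an edge have been assigned, the edge takes the value of the product of its endpoint values. The game ends when all vertices are assigned, and the score $s(G)$ is the sum of all edge values. Player P wins if $s(G) > 0$, Player N wins if $s(G) < 0$, and the game is a draw if $s(G) = 0$. Optimal play: each player's primary goal is to win and secondary goal is to force a draw; the result is the outcome under optimal play by both, regardless of which of P, N moves first unless otherwise stated. The cycle graph $C_n$ has vertices $v_1, \dots, v_n$ and edges $(v_i, v_{i+1})$ for $i = 1, \dots, n-1$ together with $(v_n, v_1)$. -}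

module Defs where

open import Data.Nat using (ℕ; zero; suc; _%_)
open import Data.Integer using (ℤ; +_; -_; _+_; _*_; _<?_; 0ℤ; 1ℤ; -1ℤ)
open import Data.Fin using (Fin; zero; suc; toℕ)
open import Data.Maybe using (Maybe; just; nothing)
open import Data.List using (List; []; _∷_; map; concatMap; foldr; allFin)
open import Data.Vec using (Vec; replicate; lookup; _[_]≔_)
open import Relation.Nullary using (yes; no)

data Player : Set where
  P N : Player

other : Player → Player
other P = N
other N = P

-- Outcome of a game, ordered N-win < draw < P-win.
-- P maximises, N minimises (primary goal: win, secondary: draw).
data Outcome : Set where
  winN draw winP : Outcome

maxO : Outcome → Outcome → Outcome
maxO winP _ = winP
maxO _ winP = winP
maxO draw _ = draw
maxO _ draw = draw
maxO winN winN = winN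

minO : Outcome → Outcome → Outcome
minO winN _ = winN
minO _ winN = winN
minO draw _ = draw
minO _ draw = draw
minO winP winP = winP

data Sign : Set where
  plus minus : Sign

signVal : Sign → ℤ
signVal plus  = 1ℤ
signVal minus = -1ℤ

-- A (partial) assignment of the vertices v_1..v_n of C_n (indexed by Fin n).
Position : ℕ → Set
Position n = Vec (Maybe Sign) n

val : Maybe Sign → ℤ
val (just s) = signVal s
val nothing  = 0ℤ

succ? : ∀ {n} → Fin n → Maybe (Fin n)
succ? {suc zero}    zero    = nothing
succ? {suc (suc n)} zero    = just (suc zero)
succ? {suc (suc n)} (suc i) with succ? i
... | just j  = just (suc j)
... | nothing = nothing

next : ∀ {n} → Fin n → Fin n
next {suc n} i with succ? i
... | just j  = j
... | nothing = zero

-- s(C_n): sum over all edges (v_i, v_{i+1 mod n}) of the product of endpoint values.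
-- Edges of C_n (n ≥ 3) are exactly { (i, i+1 mod n) }.
score : ∀ {n} → Position n → ℤ
score {n} pos = foldr _+_ 0ℤ (map (λ i → val (lookup pos i) * val (lookup pos (next i))) (allFin n))

outcomeOf : ℤ → Outcome
outcomeOf s with 0ℤ <? s
... | yes _ = winP
... | no _ with s <? 0ℤ
...   | yes _ = winN
...   | no _  = draw

moves : ∀ {n} → Position n → List (Position n)
moves {n} pos = concatMap f (allFin n)
  where
  f : Fin n → List (Position n)
  f i with lookup pos i
  ... | just _  = []
  ... | nothing = (pos [ i ]≔ just plus) ∷ (pos [ i ]≔ just minus) ∷ []

best : Player → Outcome → Outcome → Outcome
best P = maxO
best N = minO

-- Minimax value with `fuel` = number of remaining moves; `p` is the player to move.
value : ∀ {n} → ℕ → Player → Position n → Outcome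
value zero    p pos = outcomeOf (score pos)
value (suc k) p pos with moves pos
... | [] = outcomeOf (score pos)
... | m ∷ ms = foldr (best p) (value k (other p) m) (map (value k (other p)) ms)

signGameCycle : (n : ℕ) → Player → Outcome
signGameCycle n first = value n first (replicate n nothing)

winFor : Player → Outcome
winFor P = winP
winFor N = winN

{-# OPTIONS --safe #-}
-- Each player can follow a greedy strategy: while some vertex is assigned and some is not, the
-- cycle has an edge with exactly one assigned endpoint, and assigning the other endpoint makes
-- that edge good for the mover (equal signs for P, opposite signs for N).  Good edges stay good,
-- so the player moving first ends with at least ⌊(n-1)/2⌋ good edges and the player moving
-- second with at least ⌈(n-1)/2⌉.  At the end the edges good for N are the sign changes around
-- the cycle, an even number 2h, and the score is n - 4h.  The parity of 2h rounds each
-- guarantee up or down, which decides the outcome according to n mod 4.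
module Submission where

open import Defs
open import Data.Bool using (Bool; true; false)
import Data.Bool.Properties as Bool
open import Data.Fin as Fin using (Fin; zero; suc; inject₁; fromℕ)
open import Data.Fin.Properties using (¬∀⟶∃¬)
open import Data.Integer as ℤ using (ℤ; +_; _⊖_; 0ℤ; _<?_)
import Data.Integer.Properties as ℤ
import Data.Integer.Tactic.RingSolver as ℤ-Solver
open import Data.List using ([]; _∷_; foldr; tabulate; allFin)
open import Data.List.Properties using (map-tabulate)
open import Data.List.Membership.Propositional using (_∈_)
open import Data.List.Membership.Propositional.Properties
  using (∈-concatMap⁺; ∈-concatMap⁻; ∈-allFin)
open import Data.List.Relation.Unary.All as All using (All; []; _∷_)
import Data.List.Relation.Unary.All.Properties as All
open import Data.List.Relation.Unary.Any as Any using (Any; here; there)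
import Data.List.Relation.Unary.Any.Properties as Any
open import Data.Maybe using (Maybe; just; nothing)
open import Data.Nat as ℕ
  using (ℕ; zero; suc; _+_; _*_; _≤_; _<_; _≥_; _%_; _/_; _⊔_; _⊓_; ⌊_/2⌋; ⌈_/2⌉; z≤n; s≤s)
import Data.Nat.Properties as ℕ
open import Data.Nat.Divisibility using (_∣_; divides; ∣m+n∣m⇒∣n; m∣m*n)
open import Data.Nat.DivMod using (m≡m%n+[m/n]*n)
open import Data.Nat.Tactic.RingSolver using (solve-∀)
open import Algebra.Properties.Semiring.Sum ℕ.+-*-semiring
  using (sum; sum-cong-≗; ∑-distrib-+; sum-init-last; *-distribˡ-sum)
open import Data.Product using (_×_; _,_; ∃; ∃₂; proj₁; proj₂)
open import Data.Vec using ([]; _∷_; lookup; _[_]≔_; replicate)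
open import Data.Vec.Properties using (lookup∘update; lookup∘update′)
open import Function using (_∘_; _∋_; id)
open import Relation.Binary.PropositionalEquality
  using (_≡_; _≢_; refl; sym; trans; cong; cong₂; subst; subst₂; module ≡-Reasoning)
open import Relation.Nullary using (¬_; yes; no; contradiction)

rank : Outcome → ℕ
rank winN = 0
rank draw = 1
rank winP = 2

record _≼_ (a b : Outcome) : Set where
  constructor by-rank
  field rank-≤ : rank a ≤ rank b

rank≤2 : ∀ o → rank o ≤ 2
rank≤2 winN = z≤n
rank≤2 draw = s≤s z≤n
rank≤2 winP = ℕ.≤-refl

rank-maxO : ∀ a b → rank (maxO a b) ≡ rank a ⊔ rank b
rank-maxO winN winN = refl
rank-maxO winN draw = refl
rank-maxO winN winP = refl
rank-maxO draw winN = refl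
rank-maxO draw draw = refl
rank-maxO draw winP = refl
rank-maxO winP winN = refl
rank-maxO winP draw = refl
rank-maxO winP winP = refl

rank-minO : ∀ a b → rank (minO a b) ≡ rank a ⊓ rank b
rank-minO winN winN = refl
rank-minO winN draw = refl
rank-minO winN winP = refl
rank-minO draw winN = refl
rank-minO draw draw = refl
rank-minO draw winP = refl
rank-minO winP winN = refl
rank-minO winP draw = refl
rank-minO winP winP = refl

Secures : Player → Outcome → Outcome → Set
Secures P o v = o ≼ v
Secures N o v = v ≼ o

secures-bestˡ : ∀ X {o} a b → Secures X o a → Secures X o (best X a b)
secures-bestˡ P a b (by-rank o≤a) =
  by-rank (subst (_ ≤_) (sym (rank-maxO a b)) (ℕ.m≤n⇒m≤n⊔o (rank b) o≤a))
secures-bestˡ N a b (by-rank a≤o) =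
  by-rank (subst (_≤ _) (sym (rank-minO a b)) (ℕ.m≤n⇒m⊓o≤n (rank b) a≤o))

secures-bestʳ : ∀ X {o} a b → Secures X o b → Secures X o (best X a b)
secures-bestʳ P a b (by-rank o≤b) =
  by-rank (subst (_ ≤_) (sym (rank-maxO a b)) (ℕ.m≤n⇒m≤o⊔n (rank a) o≤b))
secures-bestʳ N a b (by-rank b≤o) =
  by-rank (subst (_≤ _) (sym (rank-minO a b)) (ℕ.m≤n⇒o⊓m≤n (rank a) b≤o))

secures-best-other : ∀ X {o} a b → Secures X o a → Secures X o b → Secures X o (best (other X) a b)
secures-best-other P a b (by-rank o≤a) (by-rank o≤b) =
  by-rank (subst (_ ≤_) (sym (rank-minO a b)) (ℕ.⊓-glb o≤a o≤b))
secures-best-other N a b (by-rank a≤o) (by-rank b≤o) =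
  by-rank (subst (_≤ _) (sym (rank-maxO a b)) (ℕ.⊔-lub a≤o b≤o))

secures-foldr-best : ∀ X {o} a as → Any (Secures X o) (a ∷ as) → Secures X o (foldr (best X) a as)
secures-foldr-best X a []       (here s)          = s
secures-foldr-best X a (b ∷ bs) (here s)          = secures-bestʳ X b _ (secures-foldr-best X a bs (here s))
secures-foldr-best X a (b ∷ bs) (there (here s))  = secures-bestˡ X b _ s
secures-foldr-best X a (b ∷ bs) (there (there s)) = secures-bestʳ X b _ (secures-foldr-best X a bs (there s))

secures-foldr-best-other : ∀ X {o} a as → All (Secures X o) (a ∷ as) →
                           Secures X o (foldr (best (other X)) a as)
secures-foldr-best-other X a []       (s ∷ [])     = s
secures-foldr-best-other X a (b ∷ bs) (s ∷ t ∷ ss) =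
  secures-best-other X b _ t (secures-foldr-best-other X a bs (s ∷ ss))

secures-winP : ∀ {v} → Secures P winP v → v ≡ winP
secures-winP {winP} _ = refl
secures-winP {draw} (by-rank (s≤s ()))

secures-winN : ∀ {v} → Secures N winN v → v ≡ winN
secures-winN {winN} _ = refl

secures-draw : ∀ {v} → Secures P draw v → Secures N draw v → v ≡ draw
secures-draw {draw} _ _ = refl
secures-draw {winP} _ (by-rank (s≤s ()))

outcomeOf-mono : ∀ {a b} → a ℤ.≤ b → outcomeOf a ≼ outcomeOf b
outcomeOf-mono {a} {b} a≤b with 0ℤ <? a | 0ℤ <? b
... | yes _   | yes _   = by-rank ℕ.≤-refl
... | yes 0<a | no 0≮b  = contradiction (ℤ.<-≤-trans 0<a a≤b) 0≮b
... | no _    | yes _   = by-rank (rank≤2 _)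
... | no _    | no _    with a <? 0ℤ | b <? 0ℤ
...   | yes _   | _       = by-rank z≤n
...   | no a≮0  | yes b<0 = contradiction (ℤ.≤-<-trans a≤b b<0) a≮0
...   | no _    | no _    = by-rank ℕ.≤-refl

other-involutive : ∀ X → other (other X) ≡ X
other-involutive P = refl
other-involutive N = refl

value-own : ∀ {n} X {o} k (pos : Position n) {m} → m ∈ moves pos →
            Secures X o (value k (other X) m) → Secures X o (value (suc k) X pos)
value-own X k pos m∈ s with moves pos
value-own X k pos () s | []
value-own X k pos m∈ s | _ ∷ _ =
  secures-foldr-best X _ _ (Any.map⁺ (Any.map (λ { refl → s }) m∈))

value-other : ∀ {n} X {o} k (pos : Position n) {m₀} → m₀ ∈ moves pos →
              (∀ {m} → m ∈ moves pos → Secures X o (value k X m)) →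
              Secures X o (value (suc k) (other X) pos)
value-other X k pos m₀∈ s with moves pos
value-other X k pos () s | []
value-other X {o} k pos _ s | _ ∷ _ =
  secures-foldr-best-other X _ _ (All.map⁺ (All.tabulate λ m∈ →
    subst (λ Y → Secures X o (value k Y _)) (sym (other-involutive X)) (s m∈)))

-- `moves` goes through a local helper; `embed` exposes that helper at i, so that
-- abstracting over `lookup pos i` makes it compute.
∈-moves⁺ : ∀ {n} (pos : Position n) i s → lookup pos i ≡ nothing → (pos [ i ]≔ just s) ∈ moves pos
∈-moves⁺ {n} pos i s free
  with (_ → (pos [ i ]≔ just s) ∈ moves pos) ∋
       (λ m∈ → ∈-concatMap⁺ _ {xs = allFin n} (Any.map (λ { refl → m∈ }) (∈-allFin i)))
... | embed with lookup pos i | s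
... | nothing | plus  = embed (here refl)
... | nothing | minus = embed (there (here refl))

∈-moves⁻ : ∀ {n} (pos : Position n) {m} → m ∈ moves pos →
           ∃₂ λ i s → lookup pos i ≡ nothing × m ≡ (pos [ i ]≔ just s)
∈-moves⁻ {n} pos m∈ with Any.satisfied (∈-concatMap⁻ _ {xs = allFin n} m∈)
... | i , m∈ᵢ with lookup pos i in free | m∈ᵢ
... | nothing | here refl         = i , plus , free , refl
... | nothing | there (here refl) = i , minus , free , refl

unassigned : ∀ {n} → Position n → ℕ
unassigned []              = 0
unassigned (nothing ∷ pos) = suc (unassigned pos)
unassigned (just _ ∷ pos)  = unassigned pos

Assigned : ∀ {n} → Position n → Set
Assigned {n} pos = ∃₂ λ (i : Fin n) s → lookup pos i ≡ just s

unassigned-replicate : ∀ n → unassigned (replicate n nothing) ≡ n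
unassigned-replicate zero    = refl
unassigned-replicate (suc n) = cong suc (unassigned-replicate n)

unassigned-[]≔ : ∀ {n} (pos : Position n) i s → lookup pos i ≡ nothing →
                 unassigned pos ≡ suc (unassigned (pos [ i ]≔ just s))
unassigned-[]≔ (nothing ∷ pos) zero    s _    = refl
unassigned-[]≔ (nothing ∷ pos) (suc i) s free = cong suc (unassigned-[]≔ pos i s free)
unassigned-[]≔ (just _ ∷ pos)  (suc i) s free = unassigned-[]≔ pos i s free

unassigned-move : ∀ {n k} (pos : Position n) i s → lookup pos i ≡ nothing →
                  unassigned pos ≡ suc k → unassigned (pos [ i ]≔ just s) ≡ k
unassigned-move pos i s free count =
  ℕ.suc-injective (trans (sym (unassigned-[]≔ pos i s free)) count)

unassigned-suc : ∀ {n k} (pos : Position n) → unassigned pos ≡ suc k →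
                 ∃ λ i → lookup pos i ≡ nothing
unassigned-suc (nothing ∷ pos) _     = zero , refl
unassigned-suc (just _ ∷ pos)  count = let i , free = unassigned-suc pos count in suc i , free

unassigned-zero : ∀ {n} (pos : Position n) → unassigned pos ≡ 0 →
                  ∀ i → ∃ λ s → lookup pos i ≡ just s
unassigned-zero (just s ∷ pos) full zero    = s , refl
unassigned-zero (just _ ∷ pos) full (suc i) = unassigned-zero pos full i

succ?-inject₁ : ∀ {m} (j : Fin m) → succ? {suc m} (inject₁ j) ≡ just (suc j)
succ?-inject₁ {suc m} zero    = refl
succ?-inject₁ {suc m} (suc j) rewrite succ?-inject₁ j = refl

succ?-fromℕ : ∀ m → succ? {suc m} (fromℕ m) ≡ nothing
succ?-fromℕ zero    = refl
succ?-fromℕ (suc m) rewrite succ?-fromℕ m = refl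

next-inject₁ : ∀ {m} (j : Fin m) → next {suc m} (inject₁ j) ≡ suc j
next-inject₁ j rewrite succ?-inject₁ j = refl

next-fromℕ : ∀ m → next {suc m} (fromℕ m) ≡ zero
next-fromℕ m rewrite succ?-fromℕ m = refl

constant-along-steps : ∀ {A : Set} {m} (f : Fin (suc m) → A) →
                       (∀ j → f (inject₁ j) ≡ f (suc j)) → ∀ i → f i ≡ f zero
constant-along-steps f step zero = refl
constant-along-steps {m = suc m} f step (suc i) =
  trans (constant-along-steps (f ∘ suc) (step ∘ suc) i) (sym (step zero))

sum-mono-≤ : ∀ {n} {f g : Fin n → ℕ} → (∀ i → f i ≤ g i) → sum f ≤ sum g
sum-mono-≤ {zero}  f≤g = z≤n
sum-mono-≤ {suc n} f≤g = ℕ.+-mono-≤ (f≤g zero) (sum-mono-≤ (f≤g ∘ suc))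

sum-mono-< : ∀ {n} {f g : Fin n → ℕ} → (∀ i → f i ≤ g i) → ∀ i → f i < g i → sum f < sum g
sum-mono-< f≤g zero    f<g = ℕ.+-mono-<-≤ f<g (sum-mono-≤ (f≤g ∘ suc))
sum-mono-< f≤g (suc i) f<g = ℕ.+-mono-≤-< (f≤g zero) (sum-mono-< (f≤g ∘ suc) i f<g)

sum-const-1 : ∀ n → sum {n} (λ _ → 1) ≡ n
sum-const-1 zero    = refl
sum-const-1 (suc n) = cong suc (sum-const-1 n)

sum-∘next : ∀ {n} (f : Fin n → ℕ) → sum (f ∘ next) ≡ sum f
sum-∘next {zero}  f = refl
sum-∘next {suc m} f = begin
  sum (f ∘ next)                                 ≡⟨ sum-init-last (f ∘ next) ⟩
  sum (f ∘ next ∘ inject₁) + f (next (fromℕ m))  ≡⟨ cong₂ _+_ (sum-cong-≗ (cong f ∘ next-inject₁))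
                                                                (cong f (next-fromℕ m)) ⟩
  sum (f ∘ suc) + f zero                         ≡⟨ ℕ.+-comm _ (f zero) ⟩
  sum f                                          ∎
  where open ≡-Reasoning

-- Good edges

good : Player → Sign → Sign → ℕ
good P plus  plus  = 1
good P minus minus = 1
good P _     _     = 0
good N plus  minus = 1
good N minus plus  = 1
good N _     _     = 0

reply : Player → Sign → Sign
reply P a     = a
reply N plus  = minus
reply N minus = plus

good-replyʳ : ∀ X a → good X a (reply X a) ≡ 1
good-replyʳ P plus  = refl
good-replyʳ P minus = refl
good-replyʳ N plus  = refl
good-replyʳ N minus = refl

good-replyˡ : ∀ X a → good X (reply X a) a ≡ 1
good-replyˡ P plus  = refl
good-replyˡ P minus = refl
good-replyˡ N plus  = refl
good-replyˡ N minus = refl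

goodAt : Player → Maybe Sign → Maybe Sign → ℕ
goodAt X (just a) (just b) = good X a b
goodAt X _        _        = 0

goodEdge : ∀ {n} → Player → Position n → Fin n → ℕ
goodEdge X pos i = goodAt X (lookup pos i) (lookup pos (next i))

goodEdges : ∀ {n} → Player → Position n → ℕ
goodEdges X pos = sum (goodEdge X pos)

data _⊑_ : Maybe Sign → Maybe Sign → Set where
  nothing⊑ : ∀ {y} → nothing ⊑ y
  just⊑    : ∀ {s} → just s ⊑ just s

⊑-refl : ∀ x → x ⊑ x
⊑-refl nothing  = nothing⊑
⊑-refl (just _) = just⊑

goodAt-mono : ∀ X {x x′ y y′} → x ⊑ x′ → y ⊑ y′ → goodAt X x y ≤ goodAt X x′ y′
goodAt-mono X nothing⊑ _        = z≤n
goodAt-mono X just⊑    nothing⊑ = z≤n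
goodAt-mono X just⊑    just⊑    = ℕ.≤-refl

[]≔-⊑ : ∀ {n} (pos : Position n) u s → lookup pos u ≡ nothing →
        ∀ j → lookup pos j ⊑ lookup (pos [ u ]≔ just s) j
[]≔-⊑ pos u s free j with j Fin.≟ u
... | yes refl rewrite free = nothing⊑
... | no j≢u rewrite lookup∘update′ j≢u pos (just s) = ⊑-refl _

goodEdge-[]≔-≤ : ∀ {n} X (pos : Position n) u s → lookup pos u ≡ nothing →
                 ∀ i → goodEdge X pos i ≤ goodEdge X (pos [ u ]≔ just s) i
goodEdge-[]≔-≤ X pos u s free i = goodAt-mono X ([]≔-⊑ pos u s free i) ([]≔-⊑ pos u s free (next i))

goodEdges-[]≔-≤ : ∀ {n} X (pos : Position n) u s → lookup pos u ≡ nothing →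
                  goodEdges X pos ≤ goodEdges X (pos [ u ]≔ just s)
goodEdges-[]≔-≤ X pos u s free = sum-mono-≤ (goodEdge-[]≔-≤ X pos u s free)

goodEdges-[]≔-< : ∀ {n} X (pos : Position n) u s → lookup pos u ≡ nothing → ∀ i →
                  goodEdge X pos i < goodEdge X (pos [ u ]≔ just s) i →
                  goodEdges X pos < goodEdges X (pos [ u ]≔ just s)
goodEdges-[]≔-< X pos u s free = sum-mono-< (goodEdge-[]≔-≤ X pos u s free)

isFree : Maybe Sign → Bool
isFree nothing  = true
isFree (just _) = false

boundary-edge : ∀ {n} (pos : Position n) → Assigned pos → (∃ λ j → lookup pos j ≡ nothing) →
                ∃ λ i → isFree (lookup pos i) ≢ isFree (lookup pos (next i))
boundary-edge {suc m} pos (a , _ , a-set) (b , b-free) =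
  ¬∀⟶∃¬ (suc m) _ (λ i → isFree (lookup pos i) Bool.≟ isFree (lookup pos (next i))) not-uniform
  where
  not-uniform : ¬ (∀ i → isFree (lookup pos i) ≡ isFree (lookup pos (next i)))
  not-uniform uniform = contradiction (begin
    false                     ≡⟨ cong isFree a-set ⟨
    isFree (lookup pos a)     ≡⟨ constant a ⟩
    isFree (lookup pos zero)  ≡⟨ constant b ⟨
    isFree (lookup pos b)     ≡⟨ cong isFree b-free ⟩
    true                      ∎) λ ()
    where
    open ≡-Reasoning
    constant : ∀ i → isFree (lookup pos i) ≡ isFree (lookup pos zero)
    constant = constant-along-steps (isFree ∘ lookup pos)
      (λ j → trans (uniform (inject₁ j)) (cong (isFree ∘ lookup pos) (next-inject₁ j)))

greedy-move : ∀ {n} X (pos : Position n) → Assigned pos → (∃ λ j → lookup pos j ≡ nothing) →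
              ∃₂ λ u s → lookup pos u ≡ nothing × goodEdges X pos < goodEdges X (pos [ u ]≔ just s)
greedy-move X pos assigned has-free with boundary-edge pos assigned has-free
... | i , differ with lookup pos i in eqᵢ | lookup pos (next i) in eqₙ
... | just _  | just _  = contradiction refl differ
... | nothing | nothing = contradiction refl differ
... | just a  | nothing =
  next i , reply X a , eqₙ , goodEdges-[]≔-< X pos (next i) _ eqₙ i (subst₂ _<_ before after ℕ.0<1+n)
  where
  i≢next : i ≢ next i
  i≢next i≡next = contradiction (trans (sym eqᵢ) (trans (cong (lookup pos) i≡next) eqₙ)) λ ()
  before : 0 ≡ goodEdge X pos i
  before = sym (cong₂ (goodAt X) eqᵢ eqₙ)
  after : 1 ≡ goodEdge X (pos [ next i ]≔ just (reply X a)) i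
  after = sym (trans (cong₂ (goodAt X) (trans (lookup∘update′ i≢next pos _) eqᵢ)
                                       (lookup∘update (next i) pos _))
                     (good-replyʳ X a))
... | nothing | just b =
  i , reply X b , eqᵢ , goodEdges-[]≔-< X pos i _ eqᵢ i (subst₂ _<_ before after ℕ.0<1+n)
  where
  next≢i : next i ≢ i
  next≢i next≡i = contradiction (trans (sym eqₙ) (trans (cong (lookup pos) next≡i) eqᵢ)) λ ()
  before : 0 ≡ goodEdge X pos i
  before = sym (cong₂ (goodAt X) eqᵢ eqₙ)
  after : 1 ≡ goodEdge X (pos [ i ]≔ just (reply X b)) i
  after = sym (trans (cong₂ (goodAt X) (lookup∘update i pos _)
                                       (trans (lookup∘update′ next≢i pos _) eqₙ))
                     (good-replyˡ X b))

-- The greedy strategy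

SecuredAt : Player → Outcome → ℕ → ℕ → Set
SecuredAt X o t n = (pos : Position n) → unassigned pos ≡ 0 → t ≤ goodEdges X pos →
                    Secures X o (outcomeOf (score pos))

SecuredAt-weaken : ∀ {X o t t′ n} → t ≤ t′ → SecuredAt X o t n → SecuredAt X o t′ n
SecuredAt-weaken t≤t′ secured pos full enough = secured pos full (ℕ.≤-trans t≤t′ enough)

-- With k moves left, X still makes ⌈ k /2⌉ of them when X is to move and ⌊ k /2⌋ otherwise;
-- each of X's moves from a position with an assigned vertex gains a good edge.
module GreedyStrategy (X : Player) {o t n} (secured : SecuredAt X o t n) where

  to-move : ∀ k (pos : Position n) → unassigned pos ≡ k → Assigned pos →
            t ≤ goodEdges X pos + ⌈ k /2⌉ → Secures X o (value k X pos)
  waiting : ∀ k (pos : Position n) → unassigned pos ≡ k →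
            t ≤ goodEdges X pos + ⌊ k /2⌋ → Secures X o (value k (other X) pos)

  to-move zero pos full _ enough = secured pos full (subst (t ≤_) (ℕ.+-identityʳ _) enough)
  to-move (suc k) pos count assigned enough with greedy-move X pos assigned (unassigned-suc pos count)
  ... | u , s , free , gain =
    value-own X k pos (∈-moves⁺ pos u s free)
      (waiting k (pos [ u ]≔ just s) (unassigned-move pos u s free count) (begin
        t                                          ≤⟨ enough ⟩
        goodEdges X pos + suc ⌊ k /2⌋              ≡⟨ ℕ.+-suc _ _ ⟩
        suc (goodEdges X pos) + ⌊ k /2⌋            ≤⟨ ℕ.+-monoˡ-≤ _ gain ⟩
        goodEdges X (pos [ u ]≔ just s) + ⌊ k /2⌋  ∎))
    where open ℕ.≤-Reasoning

  waiting zero pos full enough = secured pos full (subst (t ≤_) (ℕ.+-identityʳ _) enough)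
  waiting (suc k) pos count enough with unassigned-suc pos count
  ... | b , free = value-other X k pos (∈-moves⁺ pos b plus free) answer
    where
    answer : ∀ {m} → m ∈ moves pos → Secures X o (value k X m)
    answer m∈ with ∈-moves⁻ pos m∈
    ... | i , s , freeᵢ , refl =
      to-move k _ (unassigned-move pos i s freeᵢ count) (i , s , lookup∘update i pos (just s))
        (ℕ.≤-trans enough (ℕ.+-monoˡ-≤ _ (goodEdges-[]≔-≤ X pos i s freeᵢ)))

secures-first : ∀ X {o n} → SecuredAt X o ⌊ n /2⌋ (suc n) → Secures X o (signGameCycle (suc n) X)
secures-first X {n = n} secured =
  value-own X n start (∈-moves⁺ start zero plus refl)
    (waiting n _ (unassigned-move start zero plus refl (unassigned-replicate (suc n))) (ℕ.m≤n+m _ _))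
  where
  open GreedyStrategy X secured
  start : Position (suc n)
  start = replicate (suc n) nothing

secures-second : ∀ X {o n} → SecuredAt X o ⌈ n /2⌉ (suc n) →
                 Secures X o (signGameCycle (suc n) (other X))
secures-second X {o} {n} secured = value-other X n start (∈-moves⁺ start zero plus refl) answer
  where
  open GreedyStrategy X secured
  start : Position (suc n)
  start = replicate (suc n) nothing
  answer : ∀ {m} → m ∈ moves start → Secures X o (value n X m)
  answer m∈ with ∈-moves⁻ start m∈
  ... | i , s , free , refl =
    to-move n (start [ i ]≔ just s) (unassigned-move start i s free (unassigned-replicate (suc n)))
      (i , s , lookup∘update i start (just s)) (ℕ.m≤n+m _ _)

secures-from-start : ∀ X first {o n} → SecuredAt X o ⌊ n /2⌋ (suc n) →
                     Secures X o (signGameCycle (suc n) first)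
secures-from-start P P         = secures-first P
secures-from-start N N         = secures-first N
secures-from-start P N {n = n} = secures-second P ∘ SecuredAt-weaken (ℕ.⌊n/2⌋≤⌈n/2⌉ n)
secures-from-start N P {n = n} = secures-second N ∘ SecuredAt-weaken (ℕ.⌊n/2⌋≤⌈n/2⌉ n)

-- Complete positions

good-P+N : ∀ a b → good P a b + good N a b ≡ 1
good-P+N plus  plus  = refl
good-P+N plus  minus = refl
good-P+N minus plus  = refl
good-P+N minus minus = refl

signVal-*-good : ∀ a b → signVal a ℤ.* signVal b ≡ good P a b ⊖ good N a b
signVal-*-good plus  plus  = refl
signVal-*-good plus  minus = refl
signVal-*-good minus plus  = refl
signVal-*-good minus minus = refl

isMinus : Sign → ℕ
isMinus plus  = 0
isMinus minus = 1

good-N-parity : ∀ a b → 2 * (isMinus a * isMinus b) + good N a b ≡ isMinus a + isMinus b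
good-N-parity plus  plus  = refl
good-N-parity plus  minus = refl
good-N-parity minus plus  = refl
good-N-parity minus minus = refl

+-⊖-distrib : ∀ a b c d → (a ⊖ b) ℤ.+ (c ⊖ d) ≡ (a + c) ⊖ (b + d)
+-⊖-distrib a b c d = begin
  (a ⊖ b) ℤ.+ (c ⊖ d)              ≡⟨ cong₂ ℤ._+_ (ℤ.[+m]-[+n]≡m⊖n a b)
                                                    (ℤ.[+m]-[+n]≡m⊖n c d) ⟨
  (+ a ℤ.- + b) ℤ.+ (+ c ℤ.- + d)  ≡⟨ rearrange (+ a) (+ b) (+ c) (+ d) ⟩
  (+ a ℤ.+ + c) ℤ.- (+ b ℤ.+ + d)  ≡⟨ cong₂ ℤ._-_ (ℤ.pos-+ a c) (ℤ.pos-+ b d) ⟨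
  + (a + c) ℤ.- + (b + d)          ≡⟨ ℤ.[+m]-[+n]≡m⊖n (a + c) (b + d) ⟩
  (a + c) ⊖ (b + d)                ∎
  where
  open ≡-Reasoning
  rearrange : ∀ w x y z → (w ℤ.- x) ℤ.+ (y ℤ.- z) ≡ (w ℤ.+ y) ℤ.- (x ℤ.+ z)
  rearrange = ℤ-Solver.solve-∀

+-cancelʳ-⊖ : ∀ m n o → (n + m) ⊖ (o + m) ≡ n ⊖ o
+-cancelʳ-⊖ m n o = trans (cong₂ _⊖_ (ℕ.+-comm n m) (ℕ.+-comm o m)) (ℤ.+-cancelˡ-⊖ m n o)

foldr-tabulate-⊖ : ∀ {n} (e : Fin n → ℤ) (f g : Fin n → ℕ) → (∀ i → e i ≡ f i ⊖ g i) →
                   foldr ℤ._+_ 0ℤ (tabulate e) ≡ sum f ⊖ sum g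
foldr-tabulate-⊖ {zero}  e f g e≡ = refl
foldr-tabulate-⊖ {suc n} e f g e≡ =
  trans (cong₂ ℤ._+_ (e≡ zero) (foldr-tabulate-⊖ (e ∘ suc) (f ∘ suc) (g ∘ suc) (e≡ ∘ suc)))
        (+-⊖-distrib (f zero) (g zero) _ _)

m+m≡m*2 : ∀ m → m + m ≡ m * 2
m+m≡m*2 = solve-∀

module Complete {n} (pos : Position n) (full : unassigned pos ≡ 0) where

  gP gN : ℕ
  gP = goodEdges P pos
  gN = goodEdges N pos

  σ : Fin n → Sign
  σ i = proj₁ (unassigned-zero pos full i)

  lookup-σ : ∀ i → lookup pos i ≡ just (σ i)
  lookup-σ i = proj₂ (unassigned-zero pos full i)

  goodEdge-σ : ∀ X i → goodEdge X pos i ≡ good X (σ i) (σ (next i))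
  goodEdge-σ X i = cong₂ (goodAt X) (lookup-σ i) (lookup-σ (next i))

  gP+gN≡n : gP + gN ≡ n
  gP+gN≡n = begin
    gP + gN                                          ≡⟨ ∑-distrib-+ (goodEdge P pos) (goodEdge N pos) ⟨
    sum (λ i → goodEdge P pos i + goodEdge N pos i)  ≡⟨ sum-cong-≗ edge-P+N ⟩
    sum {n} (λ _ → 1)                                ≡⟨ sum-const-1 n ⟩
    n                                                ∎
    where
    open ≡-Reasoning
    edge-P+N : ∀ i → goodEdge P pos i + goodEdge N pos i ≡ 1
    edge-P+N i = trans (cong₂ _+_ (goodEdge-σ P i) (goodEdge-σ N i)) (good-P+N (σ i) (σ (next i)))

  score-complete : score pos ≡ n ⊖ (gN + gN)
  score-complete = begin
    score pos                                ≡⟨ cong (foldr ℤ._+_ 0ℤ) (map-tabulate id edgeValue) ⟩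
    foldr ℤ._+_ 0ℤ (tabulate edgeValue)      ≡⟨ foldr-tabulate-⊖ edgeValue _ _ edgeValue-good ⟩
    gP ⊖ gN                                  ≡⟨ +-cancelʳ-⊖ gN gP gN ⟨
    (gP + gN) ⊖ (gN + gN)                    ≡⟨ cong (_⊖ (gN + gN)) gP+gN≡n ⟩
    n ⊖ (gN + gN)                            ∎
    where
    open ≡-Reasoning
    edgeValue : Fin n → ℤ
    edgeValue i = val (lookup pos i) ℤ.* val (lookup pos (next i))
    edgeValue-good : ∀ i → edgeValue i ≡ goodEdge P pos i ⊖ goodEdge N pos i
    edgeValue-good i = begin
      edgeValue i                             ≡⟨ cong₂ (λ x y → val x ℤ.* val y)
                                                       (lookup-σ i) (lookup-σ (next i)) ⟩
      signVal (σ i) ℤ.* signVal (σ (next i))  ≡⟨ signVal-*-good (σ i) (σ (next i)) ⟩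
      good P (σ i) (σ (next i)) ⊖ good N (σ i) (σ (next i))
                                              ≡⟨ cong₂ _⊖_ (goodEdge-σ P i) (goodEdge-σ N i) ⟨
      goodEdge P pos i ⊖ goodEdge N pos i     ∎

  -- Summing good-N-parity over the edges counts every vertex twice, once per incident edge.
  gN-even : 2 ∣ gN
  gN-even = ∣m+n∣m⇒∣n (subst (2 ∣_) (sym count) (divides minuses (m+m≡m*2 minuses)))
                       (m∣m*n (sum both))
    where
    open ≡-Reasoning
    m both : Fin n → ℕ
    m = isMinus ∘ σ
    both i = m i * m (next i)
    minuses : ℕ
    minuses = sum m
    edge-parity : ∀ i → 2 * both i + goodEdge N pos i ≡ m i + m (next i)
    edge-parity i = trans (cong (λ x → 2 * both i + x) (goodEdge-σ N i))
                          (good-N-parity (σ i) (σ (next i)))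
    count : 2 * sum both + gN ≡ minuses + minuses
    count = begin
      2 * sum both + gN                          ≡⟨ cong (_+ gN) (*-distribˡ-sum 2 both) ⟩
      sum (λ i → 2 * both i) + gN                ≡⟨ ∑-distrib-+ (λ i → 2 * both i) (goodEdge N pos) ⟨
      sum (λ i → 2 * both i + goodEdge N pos i)  ≡⟨ sum-cong-≗ edge-parity ⟩
      sum (λ i → m i + m (next i))               ≡⟨ ∑-distrib-+ m (m ∘ next) ⟩
      minuses + sum (m ∘ next)                   ≡⟨ cong (λ x → minuses + x) (sum-∘next m) ⟩
      minuses + minuses                          ∎

q*4≡2q+2q : ∀ q → q * 4 ≡ (q + q) + (q + q)
q*4≡2q+2q = solve-∀

q+q≤⌊q*4/2⌋ : ∀ q → q + q ≤ ⌊ q * 4 /2⌋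
q+q≤⌊q*4/2⌋ q =
  ℕ.≤-reflexive (trans (ℕ.n≡⌊n+n/2⌋ (q + q)) (cong ⌊_/2⌋ (sym (q*4≡2q+2q q))))

q+q≤⌈q*4/2⌉ : ∀ q → q + q ≤ ⌈ q * 4 /2⌉
q+q≤⌈q*4/2⌉ q =
  ℕ.≤-reflexive (trans (ℕ.n≡⌈n+n/2⌉ (q + q)) (cong ⌈_/2⌉ (sym (q*4≡2q+2q q))))

m+m≤1+n+n⇒m≤n : ∀ {m n} → m + m ≤ suc (n + n) → m ≤ n
m+m≤1+n+n⇒m≤n {m} {n} le =
  subst₂ _≤_ (sym (ℕ.n≡⌊n+n/2⌋ m)) (sym (ℕ.n≡⌈n+n/2⌉ n)) (ℕ.⌊n/2⌋-mono le)

1+n+n≤m+m⇒n<m : ∀ {m n} → suc (n + n) ≤ m + m → n < m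
1+n+n≤m+m⇒n<m {m} {n} le =
  subst₂ _≤_ (cong suc (sym (ℕ.n≡⌊n+n/2⌋ n))) (sym (ℕ.n≡⌈n+n/2⌉ m)) (ℕ.⌈n/2⌉-mono le)

even-≤-odd : ∀ {g} q → 2 ∣ g → g ≤ suc (q + q) → g + g ≤ q * 4
even-≤-odd q (divides h refl) g≤ = begin
  h * 2 + h * 2      ≡⟨ cong₂ _+_ (m+m≡m*2 h) (m+m≡m*2 h) ⟨
  (h + h) + (h + h)  ≤⟨ ℕ.+-mono-≤ h+h≤q+q h+h≤q+q ⟩
  (q + q) + (q + q)  ≡⟨ q*4≡2q+2q q ⟨
  q * 4              ∎
  where
  open ℕ.≤-Reasoning
  h≤q : h ≤ q
  h≤q = m+m≤1+n+n⇒m≤n (subst (_≤ suc (q + q)) (sym (m+m≡m*2 h)) g≤)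
  h+h≤q+q : h + h ≤ q + q
  h+h≤q+q = ℕ.+-mono-≤ h≤q h≤q

even-≥-odd : ∀ {g} q → 2 ∣ g → suc (q + q) ≤ g → suc q * 4 ≤ g + g
even-≥-odd q (divides h refl) ≤g = begin
  suc q * 4                          ≡⟨ q*4≡2q+2q (suc q) ⟩
  (suc q + suc q) + (suc q + suc q)  ≤⟨ ℕ.+-mono-≤ 1+q+1+q≤h+h 1+q+1+q≤h+h ⟩
  (h + h) + (h + h)                  ≡⟨ cong₂ _+_ (m+m≡m*2 h) (m+m≡m*2 h) ⟩
  h * 2 + h * 2                      ∎
  where
  open ℕ.≤-Reasoning
  q<h : q < h
  q<h = 1+n+n≤m+m⇒n<m (subst (suc (q + q) ≤_) (sym (m+m≡m*2 h)) ≤g)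
  1+q+1+q≤h+h : suc q + suc q ≤ h + h
  1+q+1+q≤h+h = ℕ.+-mono-≤ q<h q<h

SecuredAt-P : ∀ r q {t} → r + (q + q) ≡ suc t → SecuredAt P (outcomeOf (+ r)) t (r + q * 4)
SecuredAt-P r q {t} r+2q≡1+t pos full t≤gP = outcomeOf-mono r≤score
  where
  open Complete pos full

  n≡t+1+2q : r + q * 4 ≡ t + suc (q + q)
  n≡t+1+2q = begin
    r + q * 4                ≡⟨ cong (λ x → r + x) (q*4≡2q+2q q) ⟩
    r + ((q + q) + (q + q))  ≡⟨ ℕ.+-assoc r _ _ ⟨
    (r + (q + q)) + (q + q)  ≡⟨ cong (_+ (q + q)) r+2q≡1+t ⟩
    suc t + (q + q)          ≡⟨ ℕ.+-suc t _ ⟨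
    t + suc (q + q)          ∎
    where open ≡-Reasoning

  gN≤1+2q : gN ≤ suc (q + q)
  gN≤1+2q = ℕ.+-cancelˡ-≤ t _ _
    (subst (t + gN ≤_) n≡t+1+2q (ℕ.≤-trans (ℕ.+-monoˡ-≤ gN t≤gP) (ℕ.≤-reflexive gP+gN≡n)))

  r≤score : + r ℤ.≤ score pos
  r≤score = begin
    + r                      ≡⟨ +-cancelʳ-⊖ (q * 4) r 0 ⟨
    (r + q * 4) ⊖ (q * 4)    ≤⟨ ℤ.⊖-monoʳ-≥-≤ (r + q * 4) (even-≤-odd q gN-even gN≤1+2q) ⟩
    (r + q * 4) ⊖ (gN + gN)  ≡⟨ score-complete ⟨
    score pos                ∎
    where open ℤ.≤-Reasoning

SecuredAt-N : ∀ r q → SecuredAt N (outcomeOf (r ⊖ 4)) (suc (q + q)) (r + q * 4)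
SecuredAt-N r q pos full 1+2q≤gN = outcomeOf-mono (begin
  score pos                  ≡⟨ score-complete ⟩
  (r + q * 4) ⊖ (gN + gN)    ≤⟨ ℤ.⊖-monoʳ-≥-≤ (r + q * 4) (even-≥-odd q gN-even 1+2q≤gN) ⟩
  (r + q * 4) ⊖ (4 + q * 4)  ≡⟨ +-cancelʳ-⊖ (q * 4) r 4 ⟩
  r ⊖ 4                      ∎)
  where
  open Complete pos full
  open ℤ.≤-Reasoning

signGameCycle-4q : ∀ q first → signGameCycle (q * 4) first ≡ draw
signGameCycle-4q zero    first = refl
signGameCycle-4q (suc q) first = secures-draw
  (secures-from-start P first (SecuredAt-weaken threshold (SecuredAt-P 0 (suc q) (cong suc (ℕ.+-suc q q)))))
  (secures-from-start N first (SecuredAt-weaken threshold (SecuredAt-N 4 q)))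
  where
  threshold : suc (q + q) ≤ suc ⌈ q * 4 /2⌉
  threshold = s≤s (q+q≤⌈q*4/2⌉ q)

signGameCycle-4q+1 : ∀ q first → signGameCycle (1 + q * 4) first ≡ winP
signGameCycle-4q+1 q first =
  secures-winP (secures-from-start P first (SecuredAt-weaken (q+q≤⌊q*4/2⌋ q) (SecuredAt-P 1 q refl)))

signGameCycle-4q+2 : ∀ q first → signGameCycle (2 + q * 4) first ≡ winFor (other first)
signGameCycle-4q+2 q P =
  secures-winN (secures-second N (SecuredAt-weaken (s≤s (q+q≤⌊q*4/2⌋ q)) (SecuredAt-N 2 q)))
signGameCycle-4q+2 q N =
  secures-winP (secures-second P (SecuredAt-weaken (s≤s (q+q≤⌊q*4/2⌋ q)) (SecuredAt-P 2 q refl)))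

signGameCycle-4q+3 : ∀ q first → signGameCycle (3 + q * 4) first ≡ winN
signGameCycle-4q+3 q first =
  secures-winN (secures-from-start N first (SecuredAt-weaken (s≤s (q+q≤⌊q*4/2⌋ q)) (SecuredAt-N 3 q)))

theorem6 : (n : ℕ) → n ≥ 3 → (first : Player) →
    ((n % 4 ≡ 0 → signGameCycle n first ≡ draw) ×
     (n % 4 ≡ 1 → signGameCycle n first ≡ winP) ×
     (n % 4 ≡ 2 → signGameCycle n first ≡ winFor (other first)) ×
     (n % 4 ≡ 3 → signGameCycle n first ≡ winN))
theorem6 n _ first =
    (λ r≡0 → via r≡0 (signGameCycle-4q   (n / 4) first))
  , (λ r≡1 → via r≡1 (signGameCycle-4q+1 (n / 4) first))
  , (λ r≡2 → via r≡2 (signGameCycle-4q+2 (n / 4) first))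
  , (λ r≡3 → via r≡3 (signGameCycle-4q+3 (n / 4) first))
  where
  via : ∀ {r o} → n % 4 ≡ r → signGameCycle (r + n / 4 * 4) first ≡ o → signGameCycle n first ≡ o
  via refl = subst (λ m → signGameCycle m first ≡ _) (sym (m≡m%n+[m/n]*n n 4))
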